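{- Let $n\ge 11$ and $T_{n,1}=\frac{n(n+1)}{2}-1$. Then $\#\mathbb U^*_{T_{n,1}}=1$.
   Context: A partition of $N$ into distinct parts is a sequence of positive integers $\lambda_1<\dots<\lambda_t$ summing to $N$ with $t\ge 2$. Its missing parts are the elements of $\{1,\dots,\lambda_t\}\setminus\{\lambda_1,\dots,\lambda_t\}$. $\lambda$ is refinable if two distinct missing parts sum to a part of $\lambda$, unrefinable otherwise; $\mathbb U_N$ is the set of unrefinable partitions of $N$. $\mathbb U^*_N$ is the set of $\lambda\in\mathbb U_N$ whose largest part is the maximum of the largest parts over all of $\mathbb U_N$. Standing assumption: $n\ge 11$. -}

module Defs where

open import Data.Nat using (ℕ; _+_; _*_; _∸_; _≤_; _<_; _⊔_)
open import Data.Nat.DivMod using (_/_)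
open import Data.List using (List; length; foldr)
open import Data.Nat.ListAction using (sum)
open import Data.List.Relation.Unary.All using (All)
open import Data.List.Relation.Unary.Linked using (Linked)
open import Data.List.Membership.Propositional using (_∈_; _∉_)
open import Data.Product using (_×_; ∃-syntax)
open import Relation.Binary.PropositionalEquality using (_≡_; _≢_)
open import Relation.Nullary using (¬_)

IsDistinctPartition : ℕ → List ℕ → Set
IsDistinctPartition N λs =
  Linked _<_ λs × All (1 ≤_) λs × sum λs ≡ N × 2 ≤ length λs

-- Largest part (the maximum of the list; equals λₜ for increasing lists).
largest : List ℕ → ℕ
largest = foldr _⊔_ 0

Missing : List ℕ → ℕ → Set
Missing λs a = 1 ≤ a × a ≤ largest λs × a ∉ λs

Refinable : List ℕ → Set
Refinable λs = ∃[ a ] ∃[ b ] (a ≢ b × Missing λs a × Missing λs b × (a + b) ∈ λs)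

InU : ℕ → List ℕ → Set
InU N λs = IsDistinctPartition N λs × ¬ Refinable λs

InUStar : ℕ → List ℕ → Set
InUStar N λs = InU N λs × (∀ μ → InU N μ → largest μ ≤ largest λs)

T1 : ℕ → ℕ
T1 n = (n * (n + 1)) / 2 ∸ 1

module Submission where

-- If μ is unrefinable and p is a part, then for every a with 2a < p either a or
-- p − a is a part, since otherwise they are two distinct missing parts summing to p.
-- Choosing the one that is a part maps 1, …, k (2k < p) injectively to parts
-- below p without decreasing any of them, so p + T_k ≤ |μ| with T_k = 1 + ⋯ + k,
-- strictly so unless 1, …, k are all parts. As |μ| = T_{n,1} = (n − 1) + T_{n−1},
-- the largest part is at most 2(n − 1), attained by {1, …, n − 2, 2(n − 1)}; for a
-- partition with largest part 2(n − 1) the bound with k = n − 2 is an equality,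
-- which forces the parts to be exactly 1, …, n − 2 and 2(n − 1).

open import Defs
open import Data.Nat using (ℕ; zero; suc; _+_; _*_; _∸_; _≤_; _<_; z≤n; s≤s; _≟_)
open import Data.Nat.Properties
open import Data.Nat.DivMod using (_/_; m*n/n≡m)
open import Data.Nat.ListAction using (sum)
open import Data.Nat.ListAction.Properties using (sum-++; sum-↭)
open import Data.Nat.Tactic.RingSolver using (solve-∀)
open import Data.List using (List; []; _∷_; _++_; [_]; length; map; applyUpTo)
open import Data.List.Properties using (length-++; length-applyUpTo; applyUpTo-∷ʳ)
open import Data.List.Membership.Propositional using (_∈_; _∉_; lose)
open import Data.List.Membership.Propositional.Properties
  using (∈-++⁺ˡ; ∈-++⁺ʳ; ∈-++⁻; ∈-∃++; ∈-map⁻; ∈-applyUpTo⁺; ∈-applyUpTo⁻)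
open import Data.List.Membership.Propositional.Properties.WithK using (unique∧set⇒bag)
open import Data.List.Membership.DecPropositional _≟_ using (_∈?_)
open import Data.List.Relation.Binary.Subset.Propositional using (_⊆_)
open import Data.List.Relation.Binary.BagAndSetEquality using (∼bag⇒↭; _∼[_]_; set)
open import Data.List.Relation.Binary.Permutation.Propositional using (↭⇒↭ₛ)
open import Data.List.Relation.Binary.Permutation.Propositional.Properties using (shift)
open import Data.List.Relation.Binary.Equality.Propositional using (≋⇒≡)
open import Data.List.Relation.Unary.All as All using (All; []; _∷_)
open import Data.List.Relation.Unary.All.Properties as All using ()
open import Data.List.Relation.Unary.Any using (Any; here; there)
open import Data.List.Relation.Unary.AllPairs as AllPairs using (AllPairs; []; _∷_)
open import Data.List.Relation.Unary.AllPairs.Properties as AllPairs using ()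
open import Data.List.Relation.Unary.Linked as Linked using (Linked)
open import Data.List.Relation.Unary.Linked.Properties using (Linked⇒AllPairs; AllPairs⇒Linked)
open import Data.List.Relation.Unary.Unique.Propositional using (Unique)
open import Data.List.Relation.Unary.Sorted.TotalOrder.Properties using (↗↭↗⇒≋)
open import Data.Product using (_×_; ∃-syntax; _,_; proj₁; proj₂)
open import Data.Sum using (_⊎_; inj₁; inj₂)
open import Function.Bundles using (mk⇔)
open import Relation.Binary.PropositionalEquality hiding ([_])
open import Relation.Nullary using (¬_; yes; no; contradiction)

≤-largest : ∀ {x} xs → x ∈ xs → x ≤ largest xs
≤-largest (y ∷ ys) (here refl) = m≤m⊔n y (largest ys)
≤-largest (y ∷ ys) (there x∈ys) = ≤-trans (≤-largest ys x∈ys) (m≤n⊔m y (largest ys))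

largest-≤ : ∀ {xs n} → All (_≤ n) xs → largest xs ≤ n
largest-≤ [] = z≤n
largest-≤ (x≤n ∷ xs≤n) = ⊔-lub x≤n (largest-≤ xs≤n)

largest-∈ : ∀ x xs → largest (x ∷ xs) ∈ x ∷ xs
largest-∈ x [] = here (⊔-identityʳ x)
largest-∈ x (y ∷ ys) with ⊔-sel x (largest (y ∷ ys))
... | inj₁ eq = here eq
... | inj₂ eq = there (subst (_∈ y ∷ ys) (sym eq) (largest-∈ y ys))

partition-largest-∈ : ∀ {N μ} → IsDistinctPartition N μ → largest μ ∈ μ
partition-largest-∈ {μ = x ∷ xs} _ = largest-∈ x xs

strictlySorted⇒unique : ∀ {xs} → Linked _<_ xs → Unique xs
strictlySorted⇒unique xs↗ = AllPairs.map <⇒≢ (Linked⇒AllPairs <-trans xs↗)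

strictlySorted-≡ : ∀ {xs ys} → Linked _<_ xs → Linked _<_ ys → xs ∼[ set ] ys → xs ≡ ys
strictlySorted-≡ xs↗ ys↗ xs≈ys = ≋⇒≡ (↗↭↗⇒≋ ≤-totalOrder (Linked.map <⇒≤ xs↗) (Linked.map <⇒≤ ys↗)
  (↭⇒↭ₛ (∼bag⇒↭ (unique∧set⇒bag (strictlySorted⇒unique xs↗) (strictlySorted⇒unique ys↗) xs≈ys))))

sum-⊆ : ∀ {xs ys} → Unique xs → xs ⊆ ys → sum xs ≤ sum ys
sum-⊆ [] _ = z≤n
sum-⊆ {x ∷ xs} (x∉xs ∷ xs!) xs⊆ys with ∈-∃++ (xs⊆ys (here refl))
... | as , bs , refl = begin
  x + sum xs          ≤⟨ +-monoʳ-≤ x (sum-⊆ xs! xs⊆as++bs) ⟩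
  x + sum (as ++ bs)  ≡⟨ sum-↭ (shift x as bs) ⟨
  sum (as ++ x ∷ bs)  ∎
  where
  open ≤-Reasoning
  xs⊆as++bs : xs ⊆ as ++ bs
  xs⊆as++bs {u} u∈xs with ∈-++⁻ as (xs⊆ys (there u∈xs))
  ... | inj₁ u∈as = ∈-++⁺ˡ u∈as
  ... | inj₂ (here refl) = contradiction refl (All.lookup x∉xs u∈xs)
  ... | inj₂ (there u∈bs) = ∈-++⁺ʳ as u∈bs

sum-map-≤ : ∀ {f : ℕ → ℕ} {xs} → All (λ x → x ≤ f x) xs → sum xs ≤ sum (map f xs)
sum-map-≤ [] = z≤n
sum-map-≤ (x≤fx ∷ xs≤fxs) = +-mono-≤ x≤fx (sum-map-≤ xs≤fxs)

sum-map-< : ∀ {f : ℕ → ℕ} {xs} → All (λ x → x ≤ f x) xs → Any (λ x → x < f x) xs →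
            sum xs < sum (map f xs)
sum-map-< (_ ∷ xs≤fxs) (here x<fx) = +-mono-<-≤ x<fx (sum-map-≤ xs≤fxs)
sum-map-< (x≤fx ∷ xs≤fxs) (there any) = +-mono-≤-< x≤fx (sum-map-< xs≤fxs any)

n+n<x+y : ∀ {n x y} → x ≢ y → n ≤ x → n ≤ y → n + n < x + y
n+n<x+y {n} {x} x≢y n≤x n≤y with n ≟ x
... | yes refl = +-monoʳ-< n (≤∧≢⇒< n≤y x≢y)
... | no n≢x = +-mono-<-≤ (≤∧≢⇒< n≤x n≢x) n≤y

triangle : ℕ → ℕ
triangle zero = 0
triangle (suc k) = suc k + triangle k

triangle-double : ∀ n → n * (n + 1) ≡ triangle n * 2
triangle-double zero = refl
triangle-double (suc n) = begin
  suc n * (suc n + 1)            ≡⟨ expand n ⟩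
  suc n * 2 + n * (n + 1)        ≡⟨ cong (suc n * 2 +_) (triangle-double n) ⟩
  suc n * 2 + triangle n * 2     ≡⟨ *-distribʳ-+ 2 (suc n) (triangle n) ⟨
  triangle (suc n) * 2           ∎
  where
  open ≡-Reasoning
  expand : ∀ n → suc n * (suc n + 1) ≡ suc n * 2 + n * (n + 1)
  expand = solve-∀

T1≡triangle∸1 : ∀ n → T1 n ≡ triangle n ∸ 1
T1≡triangle∸1 n = cong (_∸ 1) (trans (cong (_/ 2) (triangle-double n)) (m*n/n≡m (triangle n) 2))

T1-2+ : ∀ q → T1 (2 + q) ≡ suc q + triangle (suc q)
T1-2+ q = T1≡triangle∸1 (2 + q)

oneTo : ℕ → List ℕ
oneTo = applyUpTo suc

∈-oneTo⁺ : ∀ {a k} → 1 ≤ a → a ≤ k → a ∈ oneTo k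
∈-oneTo⁺ {suc a} _ a<k = ∈-applyUpTo⁺ suc a<k

∈-oneTo⁻ : ∀ {a k} → a ∈ oneTo k → 1 ≤ a × a ≤ k
∈-oneTo⁻ a∈ with ∈-applyUpTo⁻ suc a∈
... | i , i<k , refl = s≤s z≤n , i<k

oneTo-strictlySorted : ∀ k → AllPairs _<_ (oneTo k)
oneTo-strictlySorted k = AllPairs.applyUpTo⁺₁ suc k (λ i<j _ → s≤s i<j)

sum-oneTo : ∀ k → sum (oneTo k) ≡ triangle k
sum-oneTo zero = refl
sum-oneTo (suc k) = begin
  sum (oneTo (suc k))          ≡⟨ cong sum (applyUpTo-∷ʳ suc k) ⟨
  sum (oneTo k ++ [ suc k ])   ≡⟨ sum-++ (oneTo k) [ suc k ] ⟩
  sum (oneTo k) + (suc k + 0)  ≡⟨ cong₂ _+_ (sum-oneTo k) (+-identityʳ (suc k)) ⟩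
  triangle k + suc k           ≡⟨ +-comm (triangle k) (suc k) ⟩
  triangle (suc k)             ∎
  where open ≡-Reasoning

module Partners {μ : List ℕ} (unrefinable : ¬ Refinable μ) {p : ℕ} (p∈μ : p ∈ μ) where

  partner : ℕ → ℕ
  partner a with a ∈? μ
  ... | yes _ = a
  ... | no _ = p ∸ a

  partner-cases : ∀ {a} → a ≤ p → (a ∈ μ × partner a ≡ a) ⊎ (a ∉ μ × partner a + a ≡ p)
  partner-cases {a} a≤p with a ∈? μ
  ... | yes a∈μ = inj₁ (a∈μ , refl)
  ... | no a∉μ = inj₂ (a∉μ , m∸n+n≡m a≤p)

  partner-∈ : ∀ {a} → 1 ≤ a → a + a < p → partner a ∈ μ
  partner-∈ {a} 1≤a a+a<p with a ∈? μ
  ... | yes a∈μ = a∈μ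
  ... | no a∉μ with (p ∸ a) ∈? μ
  ...   | yes p∸a∈μ = p∸a∈μ
  ...   | no p∸a∉μ = contradiction refinable unrefinable
    where
    a<p : a < p
    a<p = ≤-<-trans (m≤m+n a a) a+a<p
    a≤largest : a ≤ largest μ
    a≤largest = ≤-trans (<⇒≤ a<p) (≤-largest μ p∈μ)
    p∸a≤largest : p ∸ a ≤ largest μ
    p∸a≤largest = ≤-trans (m∸n≤m p a) (≤-largest μ p∈μ)
    a≢p∸a : a ≢ p ∸ a
    a≢p∸a eq = <⇒≢ a+a<p (trans (cong (a +_) eq) (m+[n∸m]≡n (<⇒≤ a<p)))
    refinable : Refinable μ
    refinable = a , p ∸ a , a≢p∸a , (1≤a , a≤largest , a∉μ) , (m<n⇒0<n∸m a<p , p∸a≤largest , p∸a∉μ)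
              , subst (_∈ μ) (sym (m+[n∸m]≡n (<⇒≤ a<p))) p∈μ

  partner-≥ : ∀ {a} → a + a < p → a ≤ partner a
  partner-≥ {a} a+a<p with partner-cases (m+n≤o⇒m≤o a (<⇒≤ a+a<p))
  ... | inj₁ (_ , eq) = ≤-reflexive (sym eq)
  ... | inj₂ (_ , eq) = +-cancelʳ-≤ a a (partner a) (subst (a + a ≤_) (sym eq) (<⇒≤ a+a<p))

  partner-> : ∀ {a} → a ∉ μ → a + a < p → a < partner a
  partner-> {a} a∉μ a+a<p with partner-cases (m+n≤o⇒m≤o a (<⇒≤ a+a<p))
  ... | inj₁ (a∈μ , _) = contradiction a∈μ a∉μ
  ... | inj₂ (_ , eq) = +-cancelʳ-< a a (partner a) (subst (a + a <_) (sym eq) a+a<p)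

  partner-< : ∀ {a} → 1 ≤ a → a + a < p → partner a < p
  partner-< {a} 1≤a a+a<p with partner-cases (m+n≤o⇒m≤o a (<⇒≤ a+a<p))
  ... | inj₁ (_ , eq) = subst (_< p) (sym eq) (≤-<-trans (m≤m+n a a) a+a<p)
  ... | inj₂ (_ , eq) = subst (partner a <_) eq (m<m+n (partner a) 1≤a)

  partner-injective : ∀ {a b} → a ≢ b → a + b < p → partner a ≢ partner b
  partner-injective {a} {b} a≢b a+b<p pa≡pb
    with partner-cases (m+n≤o⇒m≤o a (<⇒≤ a+b<p)) | partner-cases (m+n≤o⇒n≤o a (<⇒≤ a+b<p))
  ... | inj₁ (_ , pa≡a) | inj₁ (_ , pb≡b) = a≢b (trans (sym pa≡a) (trans pa≡pb pb≡b))
  ... | inj₁ (_ , pa≡a) | inj₂ (_ , pb+b≡p) =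
    <⇒≢ a+b<p (trans (cong (_+ b) (trans (sym pa≡a) pa≡pb)) pb+b≡p)
  ... | inj₂ (_ , pa+a≡p) | inj₁ (_ , pb≡b) =
    <⇒≢ a+b<p (trans (+-comm a b) (trans (cong (_+ a) (trans (sym pb≡b) (sym pa≡pb))) pa+a≡p))
  ... | inj₂ (_ , pa+a≡p) | inj₂ (_ , pb+b≡p) =
    a≢b (+-cancelˡ-≡ (partner a) a b (trans pa+a≡p (trans (sym pb+b≡p) (cong (_+ b) (sym pa≡pb)))))

  partners : ℕ → List ℕ
  partners k = map partner (oneTo k)

  module _ {k : ℕ} (k+k<p : k + k < p) where

    private
      a+a<p : ∀ {a} → a ∈ oneTo k → a + a < p
      a+a<p a∈ = let a≤k = proj₂ (∈-oneTo⁻ a∈) in ≤-<-trans (+-mono-≤ a≤k a≤k) k+k<p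

      ≤-partner : All (λ a → a ≤ partner a) (oneTo k)
      ≤-partner = All.tabulate (λ a∈ → partner-≥ (a+a<p a∈))

    partners-⊆ : p ∷ partners k ⊆ μ
    partners-⊆ (here refl) = p∈μ
    partners-⊆ (there x∈) with ∈-map⁻ partner x∈
    ... | a , a∈ , refl = partner-∈ (proj₁ (∈-oneTo⁻ a∈)) (a+a<p a∈)

    partners-unique : Unique (p ∷ partners k)
    partners-unique = p∉partners ∷ AllPairs.map⁺ (AllPairs.applyUpTo⁺₁ suc k injective)
      where
      p∉partners : All (p ≢_) (partners k)
      p∉partners = All.map⁺ (All.tabulate λ a∈ → ≢-sym (<⇒≢ (partner-< (proj₁ (∈-oneTo⁻ a∈)) (a+a<p a∈))))
      injective : ∀ {i j} → i < j → j < k → partner (suc i) ≢ partner (suc j)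
      injective i<j j<k = partner-injective (<⇒≢ (s≤s i<j)) (≤-<-trans (+-mono-≤ (<-trans i<j j<k) j<k) k+k<p)

    part+triangle≤sum : p + triangle k ≤ sum μ
    part+triangle≤sum = begin
      p + triangle k        ≡⟨ cong (p +_) (sum-oneTo k) ⟨
      p + sum (oneTo k)     ≤⟨ +-monoʳ-≤ p (sum-map-≤ ≤-partner) ⟩
      sum (p ∷ partners k)  ≤⟨ sum-⊆ partners-unique partners-⊆ ⟩
      sum μ                 ∎
      where open ≤-Reasoning

    part+triangle<sum : ∀ {a} → 1 ≤ a → a ≤ k → a ∉ μ → p + triangle k < sum μ
    part+triangle<sum 1≤a a≤k a∉μ = begin-strict
      p + triangle k        ≡⟨ cong (p +_) (sum-oneTo k) ⟨
      p + sum (oneTo k)     <⟨ +-monoʳ-< p (sum-map-< ≤-partner (lose a∈ (partner-> a∉μ (a+a<p a∈)))) ⟩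
      sum (p ∷ partners k)  ≤⟨ sum-⊆ partners-unique partners-⊆ ⟩
      sum μ                 ∎
      where
      open ≤-Reasoning
      a∈ = ∈-oneTo⁺ 1≤a a≤k

-- q = n − 2
module Candidate (q : ℕ) where

  M : ℕ
  M = suc q + suc q

  q<M : q < M
  q<M = m≤m+n (suc q) (suc q)

  candidate : List ℕ
  candidate = oneTo q ++ [ M ]

  T1≡M+triangle : T1 (2 + q) ≡ M + triangle q
  T1≡M+triangle = trans (T1-2+ q) (sym (+-assoc (suc q) (suc q) (triangle q)))

  ∈-candidate⁻ : ∀ {x} → x ∈ candidate → (1 ≤ x × x ≤ q) ⊎ x ≡ M
  ∈-candidate⁻ x∈ with ∈-++⁻ (oneTo q) x∈
  ... | inj₁ x∈oneTo = inj₁ (∈-oneTo⁻ x∈oneTo)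
  ... | inj₂ (here refl) = inj₂ refl

  M∈candidate : M ∈ candidate
  M∈candidate = ∈-++⁺ʳ (oneTo q) (here refl)

  ≤M : ∀ {x} → x ∈ candidate → x ≤ M
  ≤M x∈ with ∈-candidate⁻ x∈
  ... | inj₁ (_ , x≤q) = ≤-trans x≤q (<⇒≤ q<M)
  ... | inj₂ refl = ≤-refl

  missing⇒> : ∀ {x} → 1 ≤ x → x ∉ candidate → q < x
  missing⇒> {x} 1≤x x∉ = ≰⇒> λ x≤q → x∉ (∈-++⁺ˡ (∈-oneTo⁺ 1≤x x≤q))

  candidate-strictlySorted : Linked _<_ candidate
  candidate-strictlySorted = AllPairs⇒Linked
    (AllPairs.++⁺ (oneTo-strictlySorted q) ([] ∷ [])
      (All.tabulate λ x∈ → ≤-<-trans (proj₂ (∈-oneTo⁻ x∈)) q<M ∷ []))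

  largest-candidate : largest candidate ≡ M
  largest-candidate = ≤-antisym (largest-≤ (All.tabulate ≤M)) (≤-largest candidate M∈candidate)

  sum-candidate : sum candidate ≡ T1 (2 + q)
  sum-candidate = begin
    sum (oneTo q ++ [ M ])       ≡⟨ sum-++ (oneTo q) [ M ] ⟩
    sum (oneTo q) + (M + 0)      ≡⟨ cong₂ _+_ (sum-oneTo q) (+-identityʳ M) ⟩
    triangle q + M               ≡⟨ +-comm (triangle q) M ⟩
    M + triangle q               ≡⟨ T1≡M+triangle ⟨
    T1 (2 + q)                   ∎
    where open ≡-Reasoning

  candidate-unrefinable : ¬ Refinable candidate
  candidate-unrefinable (a , b , a≢b , (1≤a , _ , a∉) , (1≤b , _ , b∉) , a+b∈) =
    <-irrefl refl (<-≤-trans (n+n<x+y a≢b (missing⇒> 1≤a a∉) (missing⇒> 1≤b b∉)) (≤M a+b∈))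

  candidate-InU : 1 ≤ q → InU (T1 (2 + q)) candidate
  candidate-InU 1≤q = (candidate-strictlySorted , All.tabulate positive , sum-candidate , two≤length)
                   , candidate-unrefinable
    where
    positive : ∀ {x} → x ∈ candidate → 1 ≤ x
    positive x∈ with ∈-candidate⁻ x∈
    ... | inj₁ (1≤x , _) = 1≤x
    ... | inj₂ refl = s≤s z≤n
    two≤length : 2 ≤ length candidate
    two≤length = subst (2 ≤_) (sym (trans (length-++ (oneTo q)) (cong (_+ 1) (length-applyUpTo suc q))))
                   (+-monoˡ-≤ 1 1≤q)

  InU⇒largest≤M : ∀ {μ} → InU (T1 (2 + q)) μ → largest μ ≤ M
  InU⇒largest≤M {μ} (partition@(_ , _ , sum≡ , _) , unrefinable) = ≮⇒≥ λ M<m →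
    <-irrefl refl (<-≤-trans M<m (≤-trans (m≤suc-q M<m) (m≤m+n (suc q) (suc q))))
    where
    open Partners unrefinable (partition-largest-∈ partition)
    m≤suc-q : M < largest μ → largest μ ≤ suc q
    m≤suc-q M<m = +-cancelʳ-≤ (triangle (suc q)) (largest μ) (suc q)
      (subst (largest μ + triangle (suc q) ≤_) (trans sum≡ (T1-2+ q)) (part+triangle≤sum M<m))

  InUStar⇒≡candidate : 1 ≤ q → ∀ {μ} → InUStar (T1 (2 + q)) μ → μ ≡ candidate
  InUStar⇒≡candidate 1≤q {μ} (inU@(partition@(μ↗ , positive , sum≡ , _) , unrefinable) , maximal) =
    strictlySorted-≡ μ↗ candidate-strictlySorted (mk⇔ μ⊆candidate candidate⊆μ)
    where
    m≡M : largest μ ≡ M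
    m≡M = ≤-antisym (InU⇒largest≤M inU)
      (subst (_≤ largest μ) largest-candidate (maximal candidate (candidate-InU 1≤q)))

    M∈μ : M ∈ μ
    M∈μ = subst (_∈ μ) m≡M (partition-largest-∈ partition)

    open Partners unrefinable M∈μ

    oneTo-⊆ : ∀ {a} → 1 ≤ a → a ≤ q → a ∈ μ
    oneTo-⊆ {a} 1≤a a≤q with a ∈? μ
    ... | yes a∈μ = a∈μ
    ... | no a∉μ = contradiction (trans sum≡ T1≡M+triangle)
      (>⇒≢ (part+triangle<sum (+-mono-< ≤-refl ≤-refl) 1≤a a≤q a∉μ))

    candidate⊆μ : candidate ⊆ μ
    candidate⊆μ x∈ with ∈-candidate⁻ x∈
    ... | inj₁ (1≤x , x≤q) = oneTo-⊆ 1≤x x≤q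
    ... | inj₂ refl = M∈μ

    μ⊆candidate : μ ⊆ candidate
    μ⊆candidate {z} z∈μ with z ∈? candidate
    ... | yes z∈ = z∈
    ... | no z∉ = contradiction z+T≤T (<⇒≱ (m<n+m (T1 (2 + q)) (All.lookup positive z∈μ)))
      where
      z∉′ : All (z ≢_) candidate
      z∉′ = All.tabulate λ { x∈ refl → z∉ x∈ }
      z∷candidate⊆μ : z ∷ candidate ⊆ μ
      z∷candidate⊆μ (here refl) = z∈μ
      z∷candidate⊆μ (there x∈) = candidate⊆μ x∈
      z+T≤T : z + T1 (2 + q) ≤ T1 (2 + q)
      z+T≤T = subst₂ (λ s t → z + s ≤ t) sum-candidate sum≡
        (sum-⊆ (z∉′ ∷ strictlySorted⇒unique candidate-strictlySorted) z∷candidate⊆μ)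

corollary2p7 : (n : ℕ) → 11 ≤ n →
    ∃[ λs ] (InUStar (T1 n) λs × ((μ : List ℕ) → InUStar (T1 n) μ → μ ≡ λs))
corollary2p7 (suc (suc q)) (s≤s (s≤s 9≤q)) =
  candidate , (candidate-InU 1≤q , maximal) , λ μ → InUStar⇒≡candidate 1≤q
  where
  open Candidate q
  -- only 3 ≤ n is needed
  1≤q : 1 ≤ q
  1≤q = ≤-trans (s≤s z≤n) 9≤q
  maximal : ∀ μ → InU (T1 (2 + q)) μ → largest μ ≤ largest candidate
  maximal μ μ∈U = subst (largest μ ≤_) (sym largest-candidate) (InU⇒largest≤M μ∈U)
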